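{- There do not exist two prefixes $\eta_1\neq\eta_2$ and microCCS processes $S,S',T,T',R$ such that $S\xrightarrow{\eta_1}S'$, $T\xrightarrow{\eta_2}T'$ and $\eta_2.S\,|\,T'\,|\,R\ \sim\ S'\,|\,\eta_1.T\,|\,R$.
   Context: MicroCCS processes: $\eta ::= a \mid \overline{a}$ (names $a$), $P ::= \mathbf{0} \mid \eta.P \mid P|Q$. Transitions: $\eta.P\xrightarrow{\eta}P$; if $P\xrightarrow{\eta}P'$, $Q\xrightarrow{\overline\eta}Q'$ then $P|Q\xrightarrow{\tau}P'|Q'$; if $P\xrightarrow{\mu}P'$ then $P|Q\xrightarrow{\mu}P'|Q$ and $Q|P\xrightarrow{\mu}Q|P'$. Strong bisimilarity $\sim$ is the union of all symmetric relations $\mathcal R$ such that $P\mathcal RQ$, $P\xrightarrow{\mu}P'$ imply $Q\xrightarrow{\mu}Q'$ with $P'\mathcal RQ'$. -}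

module Defs where

open import Data.Nat using (ℕ)
open import Data.Product using (Σ; _×_; _,_)
open import Level using (Level; suc; _⊔_) renaming (zero to lzero)

Name : Set
Name = ℕ

data Prefix : Set where
  inp : Name → Prefix
  out : Name → Prefix

co : Prefix → Prefix
co (inp a) = out a
co (out a) = inp a

data Label : Set where
  act : Prefix → Label
  τ   : Label

infixr 6 _∙_
infixl 5 _∣_
data Proc : Set where
  𝟘   : Proc
  _∙_ : Prefix → Proc → Proc
  _∣_ : Proc → Proc → Proc

data _─[_]→_ : Proc → Label → Proc → Set where
  pre  : ∀ {η P} → (η ∙ P) ─[ act η ]→ P
  com  : ∀ {P Q P' Q' η} → P ─[ act η ]→ P' → Q ─[ act (co η) ]→ Q' →
         (P ∣ Q) ─[ τ ]→ (P' ∣ Q')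
  parL : ∀ {P P' Q μ} → P ─[ μ ]→ P' → (P ∣ Q) ─[ μ ]→ (P' ∣ Q)
  parR : ∀ {P P' Q μ} → P ─[ μ ]→ P' → (Q ∣ P) ─[ μ ]→ (Q ∣ P')

record IsSymBisim (ℛ : Proc → Proc → Set) : Set where
  field
    symm : ∀ {P Q} → ℛ P Q → ℛ Q P
    sim  : ∀ {P Q μ P'} → ℛ P Q → P ─[ μ ]→ P' →
           Σ Proc (λ Q' → (Q ─[ μ ]→ Q') × ℛ P' Q')

_∼_ : Proc → Proc → Set₁
P ∼ Q = Σ (Proc → Proc → Set) (λ ℛ → IsSymBisim ℛ × ℛ P Q)

{-# OPTIONS --safe #-}
-- Colour every prefix with a Bool. For each colour c, the total size of the
-- top-level components with a prefix of colour c is a bisimulation invariant: it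
-- is determined by the size and the two switch measures, the c-switch measure is
-- unchanged by steps of colour c, and without such steps it is determined by the
-- other switch measure and the size, so induction on the size shows that
-- bisimilar processes agree on all three. Colouring by "equals a", the component
-- a ∙ T makes this quantity strictly larger on the right-hand side.
module Submission where

open import Data.Bool using (Bool; true; false; not)
open import Data.Bool.Properties using (not-¬; ¬-not) renaming (_≟_ to _≟ᵇ_)
open import Data.Empty using (⊥-elim)
open import Data.Nat using (ℕ; zero; suc; _+_; _*_; _≤_; _<_; z≤n)
open import Data.Nat.Properties
open import Algebra.Properties.CommutativeSemigroup +-commutativeSemigroup using (interchange)
open import Data.Nat.Tactic.RingSolver using (solve-∀)
open import Data.Product using (Σ; Σ-syntax; _×_; _,_; proj₁; proj₂)
open import Function using (_∘_)
open import Relation.Binary.Definitions using (DecidableEquality)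
open import Relation.Binary.PropositionalEquality
open import Relation.Nullary using (¬_; Dec; yes; no)
open import Relation.Nullary.Decidable using (does; map′; dec-true; dec-false)
open import Defs

_≟ₚ_ : DecidableEquality Prefix
inp m ≟ₚ inp n = map′ (cong inp) (λ { refl → refl }) (m ≟ n)
inp _ ≟ₚ out _ = no λ ()
out _ ≟ₚ inp _ = no λ ()
out m ≟ₚ out n = map′ (cong out) (λ { refl → refl }) (m ≟ n)

size : Proc → ℕ
size 𝟘       = 0
size (_ ∙ P) = suc (size P)
size (P ∣ Q) = size P + size Q

size-step : ∀ {P η P'} → P ─[ act η ]→ P' → size P ≡ suc (size P')
size-step pre                    = refl
size-step (parL {Q = Q} t)       = cong (_+ size Q) (size-step t)
size-step (parR {P' = P'} {Q} t) = trans (cong (size Q +_) (size-step t)) (+-suc (size Q) (size P'))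

Inert : Proc → Set
Inert P = ∀ {η P'} → ¬ P ─[ act η ]→ P'

inert-size : ∀ P → Inert P → size P ≡ 0
inert-size 𝟘       _     = refl
inert-size (_ ∙ _) inert = ⊥-elim (inert pre)
inert-size (P ∣ Q) inert = cong₂ _+_ (inert-size P (inert ∘ parL)) (inert-size Q (inert ∘ parR))

module Colouring (κ : Prefix → Bool) where

  rooted : Bool → Proc → ℕ
  rooted c 𝟘 = 0
  rooted c (η ∙ P) with κ η ≟ᵇ c
  ... | yes _ = suc (size P)
  ... | no  _ = 0
  rooted c (P ∣ Q) = rooted c P + rooted c Q

  -- The sum of the sizes of the subterms η ∙ X whose colour κ η differs from the
  -- colour of the enclosing prefix; a top-level prefix is compared with c.
  switches : Bool → Proc → ℕ
  switches c 𝟘 = 0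
  switches c (η ∙ P) with κ η ≟ᵇ c
  ... | yes _ = switches c P
  ... | no  _ = suc (size P + switches (κ η) P)
  switches c (P ∣ Q) = switches c P + switches c Q

  Step : Bool → Proc → Set
  Step c P = Σ[ η ∈ Prefix ] Σ[ P' ∈ Proc ] κ η ≡ c × P ─[ act η ]→ P'

  step? : ∀ c P → Dec (Step c P)
  step? c 𝟘 = no λ ()
  step? c (η ∙ P) with κ η ≟ᵇ c
  ... | yes e = yes (η , P , e , pre)
  ... | no ¬e = no λ { (_ , _ , e , pre) → ¬e e }
  step? c (P ∣ Q) with step? c P | step? c Q
  ... | yes (η , P' , e , t) | _                    = yes (η , P' ∣ Q , e , parL t)
  ... | no _                 | yes (η , Q' , e , t) = yes (η , P ∣ Q' , e , parR t)
  ... | no ¬p                | no ¬q                =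
    no λ { (η , _ , e , parL t) → ¬p (η , _ , e , t) ; (η , _ , e , parR t) → ¬q (η , _ , e , t) }

  inert-if-no-step : ∀ {P} → (∀ c → ¬ Step c P) → Inert P
  inert-if-no-step none t = none _ (_ , _ , refl , t)

  rooted-own-colour : ∀ {c η P} → κ η ≡ c → rooted c (η ∙ P) ≡ suc (size P)
  rooted-own-colour {c} {η} e with κ η ≟ᵇ c
  ... | yes _ = refl
  ... | no ¬e = ⊥-elim (¬e e)

  rooted-other-colour : ∀ {c η P} → κ η ≡ not c → rooted c (η ∙ P) ≡ 0
  rooted-other-colour {c} {η} e with κ η ≟ᵇ c
  ... | yes e' = ⊥-elim (not-¬ e' e)
  ... | no _  = refl

  rooted≤size : ∀ c P → rooted c P ≤ size P
  rooted≤size c 𝟘 = z≤n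
  rooted≤size c (η ∙ P) with κ η ≟ᵇ c
  ... | yes _ = ≤-refl
  ... | no  _ = z≤n
  rooted≤size c (P ∣ Q) = +-mono-≤ (rooted≤size c P) (rooted≤size c Q)

  rooted-without-step : ∀ {c} P → ¬ Step c P → rooted c P ≡ 0
  rooted-without-step 𝟘 _ = refl
  rooted-without-step {c} (η ∙ P) ¬s with κ η ≟ᵇ c
  ... | yes e = ⊥-elim (¬s (η , P , e , pre))
  ... | no  _ = refl
  rooted-without-step (P ∣ Q) ¬s =
    cong₂ _+_ (rooted-without-step P λ (η , _ , e , t) → ¬s (η , _ , e , parL t))
              (rooted-without-step Q λ (η , _ , e , t) → ¬s (η , _ , e , parR t))

  switches-of-size-zero : ∀ c P → size P ≡ 0 → switches c P ≡ 0
  switches-of-size-zero c 𝟘 _ = refl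
  switches-of-size-zero c (P ∣ Q) e =
    cong₂ _+_ (switches-of-size-zero c P (m+n≡0⇒m≡0 (size P) e))
              (switches-of-size-zero c Q (m+n≡0⇒n≡0 (size P) e))

  -- Firing a top-level prefix of colour c makes its children top-level, and
  -- they are compared with c both before and after.
  switches-step : ∀ {P η P'} → P ─[ act η ]→ P' → switches (κ η) P ≡ switches (κ η) P'
  switches-step {η = η} pre with κ η ≟ᵇ κ η
  ... | yes _ = refl
  ... | no ¬e = ⊥-elim (¬e refl)
  switches-step (parL {Q = Q} t) = cong (_+ switches _ Q) (switches-step t)
  switches-step (parR {Q = Q} t) = cong (switches _ Q +_) (switches-step t)

  rooted-switches : ∀ c P → 2 * rooted c P + switches c P ≡ switches (not c) P + size P
  rooted-switches c 𝟘 = refl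
  rooted-switches c (η ∙ P) with κ η ≟ᵇ c | κ η ≟ᵇ not c
  ... | yes refl | yes e  = ⊥-elim (not-¬ refl e)
  ... | yes refl | no _   = arith (size P) (switches (κ η) P)
    where
    arith : ∀ n s → 2 * suc n + s ≡ suc (n + s) + suc n
    arith = solve-∀
  ... | no _     | yes e  rewrite e = trans (cong suc (+-comm (size P) _)) (sym (+-suc _ (size P)))
  ... | no ¬e    | no ¬e' = ⊥-elim (¬e' (¬-not ¬e))
  rooted-switches c (P ∣ Q) = begin
    2 * (rooted c P + rooted c Q) + (switches c P + switches c Q)
      ≡⟨ cong (_+ (switches c P + switches c Q)) (*-distribˡ-+ 2 (rooted c P) (rooted c Q)) ⟩
    (2 * rooted c P + 2 * rooted c Q) + (switches c P + switches c Q)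
      ≡⟨ interchange (2 * rooted c P) (2 * rooted c Q) (switches c P) (switches c Q) ⟩
    (2 * rooted c P + switches c P) + (2 * rooted c Q + switches c Q)
      ≡⟨ cong₂ _+_ (rooted-switches c P) (rooted-switches c Q) ⟩
    (switches (not c) P + size P) + (switches (not c) Q + size Q)
      ≡⟨ interchange (switches (not c) P) (size P) (switches (not c) Q) (size Q) ⟩
    (switches (not c) P + switches (not c) Q) + (size P + size Q) ∎
    where open ≡-Reasoning

  switches-without-step : ∀ {c} P → ¬ Step c P → switches c P ≡ switches (not c) P + size P
  switches-without-step {c} P ¬s =
    subst (λ r → 2 * r + switches c P ≡ switches (not c) P + size P) (rooted-without-step P ¬s) (rooted-switches c P)

  module Invariance {ℛ : Proc → Proc → Set} (bisim : IsSymBisim ℛ) where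
    open IsSymBisim bisim

    Agree : Proc → Proc → Set
    Agree P Q = size P ≡ size Q × (∀ c → switches c P ≡ switches c Q)

    SuccessorsAgree : Proc → Set
    SuccessorsAgree P = ∀ {η P' Q'} → P ─[ act η ]→ P' → ℛ P' Q' → Agree P' Q'

    no-step-transfer : ∀ {c P Q} → ℛ P Q → ¬ Step c P → ¬ Step c Q
    no-step-transfer r ¬s (η , _ , e , t) = ¬s (η , _ , e , proj₁ (proj₂ (sim (symm r) t)))

    agree-inert : ∀ {P Q} → ℛ P Q → (∀ c → ¬ Step c P) → Agree P Q
    agree-inert {P} {Q} r none =
      trans sizeP≡0 (sym sizeQ≡0) ,
      λ c → trans (switches-of-size-zero c P sizeP≡0) (sym (switches-of-size-zero c Q sizeQ≡0))
      where
      sizeP≡0 = inert-size P (inert-if-no-step none)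
      sizeQ≡0 = inert-size Q (inert-if-no-step (no-step-transfer r ∘ none))

    agree-through-step : ∀ {c P Q} → SuccessorsAgree P → ℛ P Q → Step c P →
                         size P ≡ size Q × switches c P ≡ switches c Q
    agree-through-step ih r (η , _ , refl , t) with sim r t
    ... | _ , t' , r' with ih t r'
    ... | size≡ , switches≡ =
      trans (size-step t) (trans (cong suc size≡) (sym (size-step t'))) ,
      trans (switches-step t) (trans (switches≡ (κ η)) (sym (switches-step t')))

    agree-without-step : ∀ {c P Q} → ℛ P Q → ¬ Step c P → size P ≡ size Q →
                         switches (not c) P ≡ switches (not c) Q → switches c P ≡ switches c Q
    agree-without-step {c} {P} {Q} r ¬s size≡ switches≡ = begin
      switches c P                ≡⟨ switches-without-step P ¬s ⟩
      switches (not c) P + size P ≡⟨ cong₂ _+_ switches≡ size≡ ⟩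
      switches (not c) Q + size Q ≡⟨ switches-without-step Q (no-step-transfer r ¬s) ⟨
      switches c Q                ∎
      where open ≡-Reasoning

    agree-step : ∀ {P Q} → SuccessorsAgree P → ℛ P Q → Agree P Q
    agree-step {P} ih r with step? true P | step? false P
    ... | yes s | yes s' =
      proj₁ (agree-through-step ih r s) ,
      λ { true → proj₂ (agree-through-step ih r s) ; false → proj₂ (agree-through-step ih r s') }
    ... | yes s | no ¬s' = let size≡ , switches≡ = agree-through-step ih r s in
      size≡ , λ { true → switches≡ ; false → agree-without-step r ¬s' size≡ switches≡ }
    ... | no ¬s | yes s' = let size≡ , switches≡ = agree-through-step ih r s' in
      size≡ , λ { true → agree-without-step r ¬s size≡ switches≡ ; false → switches≡ }
    ... | no ¬s | no ¬s' = agree-inert r λ { true → ¬s ; false → ¬s' }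

    agree : ∀ n {P Q} → size P ≡ n → ℛ P Q → Agree P Q
    agree zero    size≡0 = agree-step λ t → ⊥-elim (0≢1+n (trans (sym size≡0) (size-step t)))
    agree (suc n) size≡  = agree-step λ t → agree n (suc-injective (trans (sym (size-step t)) size≡))

    rooted-invariant : ∀ c {P Q} → ℛ P Q → rooted c P ≡ rooted c Q
    rooted-invariant c {P} {Q} r =
      *-cancelˡ-≡ _ _ 2 (+-cancelʳ-≡ (switches c P) _ _ (begin
        2 * rooted c P + switches c P ≡⟨ rooted-switches c P ⟩
        switches (not c) P + size P   ≡⟨ cong₂ _+_ (switches≡ (not c)) size≡ ⟩
        switches (not c) Q + size Q   ≡⟨ rooted-switches c Q ⟨
        2 * rooted c Q + switches c Q ≡⟨ cong (2 * rooted c Q +_) (switches≡ c) ⟨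
        2 * rooted c Q + switches c P ∎))
      where
      open ≡-Reasoning
      size≡ = proj₁ (agree _ refl r)
      switches≡ = proj₂ (agree _ refl r)

module Separation (a : Prefix) where
  open Colouring (λ η → does (η ≟ₚ a)) public

  rooted-gap : ∀ {b S S' T T' R} → b ≢ a → T ─[ act b ]→ T' →
               rooted true (b ∙ S ∣ T' ∣ R) < rooted true (S' ∣ a ∙ T ∣ R)
  rooted-gap {b} {S} {S'} {T} {T'} {R} b≢a t = begin-strict
    rooted true (b ∙ S) + rooted true T' + rooted true R
      ≡⟨ cong (λ x → x + rooted true T' + rooted true R) (rooted-other-colour (dec-false (b ≟ₚ a) b≢a)) ⟩
    rooted true T' + rooted true R
      ≤⟨ +-monoˡ-≤ _ (rooted≤size true T') ⟩
    size T' + rooted true R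
      <⟨ +-monoˡ-< _ (≤-reflexive (sym (size-step t))) ⟩
    size T + rooted true R
      ≤⟨ +-monoˡ-≤ _ (≤-trans (n≤1+n (size T)) (m≤n+m _ (rooted true S'))) ⟩
    rooted true S' + suc (size T) + rooted true R
      ≡⟨ cong (λ x → rooted true S' + x + rooted true R) (rooted-own-colour (dec-true (a ≟ₚ a) refl)) ⟨
    rooted true S' + rooted true (a ∙ T) + rooted true R ∎
    where open ≤-Reasoning

lemma4p4 : ¬ Σ Prefix (λ η₁ → Σ Prefix (λ η₂ → Σ Proc (λ S → Σ Proc (λ S' → Σ Proc (λ T → Σ Proc (λ T' → Σ Proc (λ R →
               (¬ η₁ ≡ η₂) × (S ─[ act η₁ ]→ S') × (T ─[ act η₂ ]→ T') ×
               (((η₂ ∙ S) ∣ T' ∣ R) ∼ (S' ∣ (η₁ ∙ T) ∣ R)))))))))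
lemma4p4 (a , b , S , S' , T , T' , R , a≢b , _ , T→T' , _ , bisim , r) =
  <-irrefl (rooted-invariant true r) (rooted-gap {S = S} {S'} {T} {T'} {R} (a≢b ∘ sym) T→T')
  where
  open Separation a
  open Invariance bisim
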